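{- Let $\mathcal{C}$ be a category equipped with an object extension structure $X$. For every term-structure $Y$ over $X$ there is a $q$-morphism structure over $X$ that is compatible with $Y$.
   Context: Composition is written diagrammatically ($f;g$ for $f$ then $g$); for a presheaf $P$, $f^*x=P(f)(x)$; $y$ is the Yoneda embedding, $\bar x$ the Yoneda transpose. An object extension structure on $\mathcal{C}$ consists of a presheaf $\mathrm{Ty}:\mathcal{C}^{op}\to\mathbf{Set}$ and, for each object $\Gamma$ and $A\in\mathrm{Ty}(\Gamma)$, an object $\Gamma.A$ and a morphism $\pi_A:\Gamma.A\to\Gamma$. A term-structure over it consists of a presheaf $\mathrm{Tm}$, a natural transformation $p:\mathrm{Tm}\to\mathrm{Ty}$, and for each $\Gamma$, $A\in\mathrm{Ty}(\Gamma)$ an element $\mathrm{te}_A\in\mathrm{Tm}(\Gamma.A)$ with $p(\mathrm{te}_A)=\pi_A^*A$ such that the square $\overline{\mathrm{te}_A}:y(\Gamma.A)\to\mathrm{Tm}$, $y(\pi_A):y(\Gamma.A)\to y(\Gamma)$, $p$, $\bar A:y(\Gamma)\to\mathrm{Ty}$ is a pullback of presheaves. A $q$-morphism structure over it assigns to each $f:\Gamma'\to\Gamma$ and $A\in\mathrm{Ty}(\Gamma)$ a morphism $q(f,A):\Gamma'.f^*A\to\Gamma.A$ with $q(f,A);\pi_A=\pi_{f^*A};f$ and the resulting square a pullback, such that $q(1_\Gamma,A)$ equals the isomorphism $\Gamma.1_\Gamma^*A\cong\Gamma.A$ induced by the functoriality equality $1_\Gamma^*A=A$, and $q(f';f,A)$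 equals the composite of the isomorphism $\Gamma''.(f';f)^*A\cong\Gamma''.f'^*f^*A$ (induced by the functoriality equality) followed by $q(f',f^*A)$ and then $q(f,A)$. A term-structure and a $q$-morphism structure over $X$ are compatible if for all $f:\Gamma'\to\Gamma$ and $A\in\mathrm{Ty}(\Gamma)$, $\mathrm{te}_{f^*A}=q(f,A)^*\,\mathrm{te}_A$. -}

module Defs where

open import Level using (Level; _⊔_) renaming (suc to lsuc)
open import Data.Product using (Σ; _×_; _,_)
open import Relation.Binary.PropositionalEquality using (_≡_; refl)

-- Categories, composition written diagrammatically: f ⨾ g is "f then g".
record Category (o h : Level) : Set (lsuc (o ⊔ h)) where
  infixr 9 _⨾_
  field
    Obj  : Set o
    Hom  : Obj → Obj → Set h
    id   : ∀ {A} → Hom A A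
    _⨾_  : ∀ {A B C} → Hom A B → Hom B C → Hom A C
    idˡ  : ∀ {A B} (f : Hom A B) → id ⨾ f ≡ f
    idʳ  : ∀ {A B} (f : Hom A B) → f ⨾ id ≡ f
    assoc : ∀ {A B C D} (f : Hom A B) (g : Hom B C) (k : Hom C D) →
            (f ⨾ g) ⨾ k ≡ f ⨾ (g ⨾ k)

module _ {o h : Level} (𝒞 : Category o h) where
  open Category 𝒞

  record IsPullback {W A B D : Obj} (top : Hom W B) (left : Hom W A)
                    (right : Hom B D) (bottom : Hom A D) : Set (o ⊔ h) where
    field
      commutes  : top ⨾ right ≡ left ⨾ bottom
      universal : ∀ {Q} (a : Hom Q B) (b : Hom Q A) → a ⨾ right ≡ b ⨾ bottom →
                  Σ (Hom Q W) λ u → (u ⨾ top ≡ a) × (u ⨾ left ≡ b) ×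
                    (∀ (u' : Hom Q W) → u' ⨾ top ≡ a → u' ⨾ left ≡ b → u' ≡ u)

  -- Presheaves 𝒞^op → Set h.  F₁ f x is f^* x.
  record Presheaf : Set (o ⊔ lsuc h) where
    field
      F₀    : Obj → Set h
      F₁    : ∀ {Δ Γ} → Hom Δ Γ → F₀ Γ → F₀ Δ
      F-id  : ∀ {Γ} (x : F₀ Γ) → F₁ id x ≡ x
      F-comp : ∀ {Θ Δ Γ} (f : Hom Θ Δ) (g : Hom Δ Γ) (x : F₀ Γ) →
               F₁ (f ⨾ g) x ≡ F₁ f (F₁ g x)
  open Presheaf public

  record NatTrans (P Q : Presheaf) : Set (o ⊔ h) where
    field
      η       : ∀ Γ → F₀ P Γ → F₀ Q Γ
      natural : ∀ {Δ Γ} (f : Hom Δ Γ) (x : F₀ P Γ) →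
                η Δ (F₁ P f x) ≡ F₁ Q f (η Γ x)
  open NatTrans public

  _≈ₙ_ : {P Q : Presheaf} → NatTrans P Q → NatTrans P Q → Set (o ⊔ h)
  α ≈ₙ β = ∀ Γ x → η α Γ x ≡ η β Γ x

  _⊙_ : {P Q R : Presheaf} → NatTrans P Q → NatTrans Q R → NatTrans P R
  _⊙_ {P} {Q} {R} α β = record
    { η = λ Γ x → η β Γ (η α Γ x)
    ; natural = λ f x → trans′ (cong′ (η β _) (natural α f x)) (natural β f (η α _ x)) }
    where
      cong′ : ∀ {a b : Level} {A : Set a} {B : Set b} (g : A → B) {x y : A} → x ≡ y → g x ≡ g y
      cong′ g refl = refl
      trans′ : ∀ {a : Level} {A : Set a} {x y z : A} → x ≡ y → y ≡ z → x ≡ z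
      trans′ refl q = q

  record IsPullbackPsh {W A B D : Presheaf} (top : NatTrans W B) (left : NatTrans W A)
                       (right : NatTrans B D) (bottom : NatTrans A D) : Set (o ⊔ lsuc h) where
    field
      commutes  : (top ⊙ right) ≈ₙ (left ⊙ bottom)
      universal : ∀ (Q : Presheaf) (a : NatTrans Q B) (b : NatTrans Q A) →
                  (a ⊙ right) ≈ₙ (b ⊙ bottom) →
                  Σ (NatTrans Q W) λ u → ((u ⊙ top) ≈ₙ a) × ((u ⊙ left) ≈ₙ b) ×
                    (∀ (u' : NatTrans Q W) → (u' ⊙ top) ≈ₙ a → (u' ⊙ left) ≈ₙ b → u' ≈ₙ u)

  y : Obj → Presheaf
  y Γ = record
    { F₀ = λ Δ → Hom Δ Γ
    ; F₁ = λ f g → f ⨾ g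
    ; F-id = idˡ
    ; F-comp = assoc }

  y₁ : ∀ {Δ Γ} → Hom Δ Γ → NatTrans (y Δ) (y Γ)
  y₁ f = record
    { η = λ Θ g → g ⨾ f
    ; natural = λ k g → assoc k g f }

  transpose : (P : Presheaf) {Γ : Obj} → F₀ P Γ → NatTrans (y Γ) P
  transpose P x = record
    { η = λ Δ g → F₁ P g x
    ; natural = λ k g → F-comp P k g x }

  record ObjExt : Set (o ⊔ lsuc h) where
    field
      Ty  : Presheaf
      ext : (Γ : Obj) → F₀ Ty Γ → Obj          -- Γ.A
      π   : {Γ : Obj} (A : F₀ Ty Γ) → Hom (ext Γ A) Γ

  module _ (X : ObjExt) where
    open ObjExt X

    eqIso : {Γ : Obj} {B A : F₀ Ty Γ} → B ≡ A → Hom (ext Γ B) (ext Γ A)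
    eqIso refl = id

    record TermStr : Set (o ⊔ lsuc h) where
      field
        Tm    : Presheaf
        p     : NatTrans Tm Ty
        te    : {Γ : Obj} (A : F₀ Ty Γ) → F₀ Tm (ext Γ A)
        te-ty : {Γ : Obj} (A : F₀ Ty Γ) → η p (ext Γ A) (te A) ≡ F₁ Ty (π A) A
        te-pb : {Γ : Obj} (A : F₀ Ty Γ) →
                IsPullbackPsh (transpose Tm (te A)) (y₁ (π A)) p (transpose Ty A)

    record QMorStr : Set (o ⊔ h) where
      field
        q      : {Γ' Γ : Obj} (f : Hom Γ' Γ) (A : F₀ Ty Γ) →
                 Hom (ext Γ' (F₁ Ty f A)) (ext Γ A)
        q-pb   : {Γ' Γ : Obj} (f : Hom Γ' Γ) (A : F₀ Ty Γ) →
                 IsPullback (q f A) (π (F₁ Ty f A)) (π A) f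
        q-id   : {Γ : Obj} (A : F₀ Ty Γ) → q id A ≡ eqIso (F-id Ty A)
        q-comp : {Γ'' Γ' Γ : Obj} (f' : Hom Γ'' Γ') (f : Hom Γ' Γ) (A : F₀ Ty Γ) →
                 q (f' ⨾ f) A ≡ eqIso (F-comp Ty f' f A) ⨾ q f' (F₁ Ty f A) ⨾ q f A

    Compatible : TermStr → QMorStr → Set (o ⊔ h)
    Compatible Y Q = ∀ {Γ' Γ : Obj} (f : Hom Γ' Γ) (A : F₀ Ty Γ) →
      TermStr.te Y (F₁ Ty f A) ≡ F₁ (TermStr.Tm Y) (QMorStr.q Q f A) (TermStr.te Y A)

-- The pullback condition on te_A says that Γ.A represents the pairs (t , b) with
-- t ∈ Tm(Q), b : Q → Γ and p t = b^* A.  Define q(f,A) : Γ'.f^*A → Γ.A as the map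
-- classifying (te_{f^*A} , π_{f^*A} ; f); compatibility then holds by construction.
-- Since a map into Γ.A is determined by the term it pulls te_A back to and by its
-- composite with π_A, the pullback property of q(f,A) and its identity and
-- composition laws reduce to comparing these two components.
module Submission where

open import Defs
open import Level using (Level)
open import Data.Product using (Σ; _,_; _×_; proj₁; proj₂)
open import Relation.Binary.PropositionalEquality
open ≡-Reasoning

module _ {o h : Level} (𝒞 : Category o h) where
  open Category 𝒞

  module RepresentsPullback {P R : Presheaf 𝒞} (α : NatTrans 𝒞 P R)
    {E Γ : Obj} {x : F₀ P E} {g : Hom E Γ} {r : F₀ R Γ}
    (pb : IsPullbackPsh 𝒞 (transpose 𝒞 P x) (y₁ 𝒞 g) α (transpose 𝒞 R r)) where
    open IsPullbackPsh pb

    elt-matches : ∀ {Q} (m : Hom Q E) → η α Q (F₁ P m x) ≡ F₁ R (m ⨾ g) r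
    elt-matches {Q} m = commutes Q m

    cone : ∀ {Q} (t : F₀ P Q) (b : Hom Q Γ) → η α Q t ≡ F₁ R b r →
           ∀ Δ (k : Hom Δ Q) → η α Δ (F₁ P k t) ≡ F₁ R (k ⨾ b) r
    cone t b e Δ k = begin
      η α Δ (F₁ P k t)   ≡⟨ natural α k t ⟩
      F₁ R k (η α _ t)   ≡⟨ cong (F₁ R k) e ⟩
      F₁ R k (F₁ R b r)  ≡⟨ sym (F-comp R k b r) ⟩
      F₁ R (k ⨾ b) r     ∎

    module _ {Q : Obj} (t : F₀ P Q) (b : Hom Q Γ) (e : η α Q t ≡ F₁ R b r) where
      open Σ (universal (y 𝒞 Q) (transpose 𝒞 P t) (y₁ 𝒞 b) (cone t b e))
        using () renaming (proj₁ to mediator; proj₂ to mediates)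

      lift : Hom Q E
      lift = η mediator Q id

      lift-elt : F₁ P lift x ≡ t
      lift-elt = trans (proj₁ mediates Q id) (F-id P t)

      lift-hom : lift ⨾ g ≡ b
      lift-hom = trans (proj₁ (proj₂ mediates) Q id) (idˡ b)

      lift-unique : (m : Hom Q E) → F₁ P m x ≡ t → m ⨾ g ≡ b → m ≡ lift
      lift-unique m m-elt m-hom =
        trans (sym (idˡ m)) (proj₂ (proj₂ mediates) (y₁ 𝒞 m) elt≈ hom≈ Q id)
        where
        elt≈ : ∀ Δ (k : Hom Δ Q) → F₁ P (k ⨾ m) x ≡ F₁ P k t
        elt≈ Δ k = trans (F-comp P k m x) (cong (F₁ P k) m-elt)
        hom≈ : ∀ Δ (k : Hom Δ Q) → (k ⨾ m) ⨾ g ≡ k ⨾ b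
        hom≈ Δ k = trans (assoc k m g) (cong (k ⨾_) m-hom)

    lift-ext : ∀ {Q} (m m' : Hom Q E) → F₁ P m x ≡ F₁ P m' x → m ⨾ g ≡ m' ⨾ g → m ≡ m'
    lift-ext m m' same-elt same-hom =
      trans (lift-unique _ _ (elt-matches m) m refl refl)
            (sym (lift-unique _ _ (elt-matches m) m' (sym same-elt) (sym same-hom)))

module Construction {o h : Level} (𝒞 : Category o h) (X : ObjExt 𝒞) (Y : TermStr 𝒞 X) where
  open Category 𝒞
  open ObjExt X
  open TermStr Y

  module Ext {Γ : Obj} (A : F₀ Ty Γ) = RepresentsPullback 𝒞 p (te-pb A)

  te-ty-along : ∀ {Γ' Γ} (f : Hom Γ' Γ) (A : F₀ Ty Γ) →
                η p _ (te (F₁ Ty f A)) ≡ F₁ Ty (π (F₁ Ty f A) ⨾ f) A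
  te-ty-along f A = trans (te-ty (F₁ Ty f A)) (sym (F-comp Ty (π (F₁ Ty f A)) f A))

  q : ∀ {Γ' Γ} (f : Hom Γ' Γ) (A : F₀ Ty Γ) → Hom (ext Γ' (F₁ Ty f A)) (ext Γ A)
  q f A = Ext.lift A (te (F₁ Ty f A)) (π (F₁ Ty f A) ⨾ f) (te-ty-along f A)

  q-te : ∀ {Γ' Γ} (f : Hom Γ' Γ) (A : F₀ Ty Γ) → F₁ Tm (q f A) (te A) ≡ te (F₁ Ty f A)
  q-te f A = Ext.lift-elt A _ _ (te-ty-along f A)

  q-π : ∀ {Γ' Γ} (f : Hom Γ' Γ) (A : F₀ Ty Γ) → q f A ⨾ π A ≡ π (F₁ Ty f A) ⨾ f
  q-π f A = Ext.lift-hom A _ _ (te-ty-along f A)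

  te-along-⨾q : ∀ {Q Γ' Γ} (f : Hom Γ' Γ) (A : F₀ Ty Γ) (v : Hom Q (ext Γ' (F₁ Ty f A))) →
                F₁ Tm (v ⨾ q f A) (te A) ≡ F₁ Tm v (te (F₁ Ty f A))
  te-along-⨾q f A v = trans (F-comp Tm v (q f A) (te A)) (cong (F₁ Tm v) (q-te f A))

  te-eqIso : ∀ {Γ} {B A : F₀ Ty Γ} (e : B ≡ A) → F₁ Tm (eqIso 𝒞 X e) (te A) ≡ te B
  te-eqIso refl = F-id Tm _

  eqIso-π : ∀ {Γ} {B A : F₀ Ty Γ} (e : B ≡ A) → eqIso 𝒞 X e ⨾ π A ≡ π B
  eqIso-π refl = idˡ _

  q-pb : ∀ {Γ' Γ} (f : Hom Γ' Γ) (A : F₀ Ty Γ) → IsPullback 𝒞 (q f A) (π (F₁ Ty f A)) (π A) f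
  q-pb {Γ'} f A = record { commutes = q-π f A ; universal = universal }
    where
    fA : F₀ Ty Γ'
    fA = F₁ Ty f A
    universal : ∀ {Q} (a : Hom Q (ext _ A)) (b : Hom Q Γ') → a ⨾ π A ≡ b ⨾ f →
      Σ (Hom Q (ext Γ' fA)) λ u → (u ⨾ q f A ≡ a) × (u ⨾ π fA ≡ b) ×
        (∀ u' → u' ⨾ q f A ≡ a → u' ⨾ π fA ≡ b → u' ≡ u)
    universal a b square = u , u-q , Ext.lift-hom fA _ _ matches , u-unique
      where
      matches : η p _ (F₁ Tm a (te A)) ≡ F₁ Ty b fA
      matches = begin
        η p _ (F₁ Tm a (te A))  ≡⟨ Ext.elt-matches A a ⟩
        F₁ Ty (a ⨾ π A) A       ≡⟨ cong (λ k → F₁ Ty k A) square ⟩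
        F₁ Ty (b ⨾ f) A         ≡⟨ F-comp Ty b f A ⟩
        F₁ Ty b fA              ∎
      u : Hom _ (ext Γ' fA)
      u = Ext.lift fA (F₁ Tm a (te A)) b matches
      u-q : u ⨾ q f A ≡ a
      u-q = Ext.lift-ext A (u ⨾ q f A) a
        (trans (te-along-⨾q f A u) (Ext.lift-elt fA _ _ matches))
        (begin
          (u ⨾ q f A) ⨾ π A     ≡⟨ assoc u (q f A) (π A) ⟩
          u ⨾ (q f A ⨾ π A)     ≡⟨ cong (u ⨾_) (q-π f A) ⟩
          u ⨾ (π fA ⨾ f)        ≡⟨ sym (assoc u (π fA) f) ⟩
          (u ⨾ π fA) ⨾ f        ≡⟨ cong (_⨾ f) (Ext.lift-hom fA _ _ matches) ⟩
          b ⨾ f                 ≡⟨ sym square ⟩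
          a ⨾ π A               ∎)
      u-unique : ∀ u' → u' ⨾ q f A ≡ a → u' ⨾ π fA ≡ b → u' ≡ u
      u-unique u' u'-q u'-π = Ext.lift-unique fA _ _ matches u'
        (trans (sym (te-along-⨾q f A u')) (cong (λ k → F₁ Tm k (te A)) u'-q)) u'-π

  q-id : ∀ {Γ} (A : F₀ Ty Γ) → q id A ≡ eqIso 𝒞 X (F-id Ty A)
  q-id A = Ext.lift-ext A _ _
    (trans (q-te id A) (sym (te-eqIso (F-id Ty A))))
    (trans (trans (q-π id A) (idʳ _)) (sym (eqIso-π (F-id Ty A))))

  q-comp : ∀ {Γ'' Γ' Γ} (f' : Hom Γ'' Γ') (f : Hom Γ' Γ) (A : F₀ Ty Γ) →
           q (f' ⨾ f) A ≡ eqIso 𝒞 X (F-comp Ty f' f A) ⨾ q f' (F₁ Ty f A) ⨾ q f A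
  q-comp {Γ''} {Γ'} f' f A = Ext.lift-ext A _ _
    (begin
      F₁ Tm (q (f' ⨾ f) A) (te A)            ≡⟨ q-te (f' ⨾ f) A ⟩
      te (F₁ Ty (f' ⨾ f) A)                  ≡⟨ sym (te-eqIso e) ⟩
      F₁ Tm i (te (F₁ Ty f' fA))             ≡⟨ cong (F₁ Tm i) (sym (q-te f' fA)) ⟩
      F₁ Tm i (F₁ Tm (q f' fA) (te fA))      ≡⟨ sym (F-comp Tm i (q f' fA) (te fA)) ⟩
      F₁ Tm (i ⨾ q f' fA) (te fA)            ≡⟨ sym (te-along-⨾q f A (i ⨾ q f' fA)) ⟩
      F₁ Tm ((i ⨾ q f' fA) ⨾ q f A) (te A)   ≡⟨ cong (λ k → F₁ Tm k (te A)) (assoc i (q f' fA) (q f A)) ⟩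
      F₁ Tm (i ⨾ q f' fA ⨾ q f A) (te A)     ∎)
    (begin
      q (f' ⨾ f) A ⨾ π A                     ≡⟨ q-π (f' ⨾ f) A ⟩
      π (F₁ Ty (f' ⨾ f) A) ⨾ f' ⨾ f          ≡⟨ cong (_⨾ f' ⨾ f) (sym (eqIso-π e)) ⟩
      (i ⨾ π (F₁ Ty f' fA)) ⨾ f' ⨾ f         ≡⟨ assoc _ _ _ ⟩
      i ⨾ π (F₁ Ty f' fA) ⨾ f' ⨾ f           ≡⟨ cong (i ⨾_) (sym (assoc _ _ _)) ⟩
      i ⨾ (π (F₁ Ty f' fA) ⨾ f') ⨾ f         ≡⟨ cong (λ k → i ⨾ k ⨾ f) (sym (q-π f' fA)) ⟩
      i ⨾ (q f' fA ⨾ π fA) ⨾ f               ≡⟨ cong (i ⨾_) (assoc _ _ _) ⟩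
      i ⨾ q f' fA ⨾ π fA ⨾ f                 ≡⟨ cong (λ k → i ⨾ q f' fA ⨾ k) (sym (q-π f A)) ⟩
      i ⨾ q f' fA ⨾ q f A ⨾ π A              ≡⟨ cong (i ⨾_) (sym (assoc _ _ _)) ⟩
      i ⨾ (q f' fA ⨾ q f A) ⨾ π A            ≡⟨ sym (assoc _ _ _) ⟩
      (i ⨾ q f' fA ⨾ q f A) ⨾ π A            ∎)
    where
    fA : F₀ Ty Γ'
    fA = F₁ Ty f A
    e : F₁ Ty (f' ⨾ f) A ≡ F₁ Ty f' fA
    e = F-comp Ty f' f A
    i : Hom (ext Γ'' (F₁ Ty (f' ⨾ f) A)) (ext Γ'' (F₁ Ty f' fA))
    i = eqIso 𝒞 X e

  qMorStr : QMorStr 𝒞 X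
  qMorStr = record { q = q ; q-pb = q-pb ; q-id = q-id ; q-comp = q-comp }

mainTheorem3 : {o h : Level} (𝒞 : Category o h) (X : ObjExt 𝒞) (Y : TermStr 𝒞 X) →
    Σ (QMorStr 𝒞 X) (λ Q → Compatible 𝒞 X Y Q)
mainTheorem3 𝒞 X Y = qMorStr , λ f A → sym (q-te f A)
  where open Construction 𝒞 X Y
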